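{- Let $d\ge2$, $p\ge1$, $k\ge1$. For each integer $m\ge1$, the function $$J_m(T):=N_{\ge m(p-1)+1}(T)\prod_{i=1}^{m-1}N_{\le i(p-1)}(T)$$ on $\mathcal{C}_k^{(d)}$ lies in the span of the indicator functions of the length-$p$ shuffle classes in $\mathcal{C}_k^{(d)}$.
   Context: A $d$-Catalan tree is a rooted planar tree in which every vertex has $0$ or $d$ children; $\mathcal{C}_k^{(d)}$ is the set of such trees with $k$ internal vertices. $N_j(T)$ is the number of vertices of $T$ at graph distance $j$ from the root, $N_{\le q}(T)=\sum_{0\le j\le q}N_j(T)$ and $N_{\ge q}(T)=\sum_{j\ge q}N_j(T)$. For an ancestral path $(v_0,\dots,v_p)$ (each $v_i$ a child of $v_{i-1}$) in $T$, the shuffle class is the set of trees in $\mathcal{C}_k^{(d)}$ obtainable from $T$ by rearranging the $(d-1)p$ subtrees subtended by the siblings of $v_1,\dots,v_p$ among these sibling positions; a length-$p$ shuffle class is any such set. The empty product equals $1$. -}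

module Defs where

open import Data.Nat using (ℕ; zero; suc; _+_; _*_; _∸_)
open import Data.Fin using (Fin)
open import Data.Fin.Properties using (_≟_)
open import Data.Vec using (Vec; []; _∷_; lookup; _[_]≔_)
open import Data.List using (List; []; _∷_; _++_; map; upTo; filter; allFin; length)
open import Data.Nat.ListAction using (sum; product)
open import Data.List.Relation.Binary.Permutation.Propositional using (_↭_)
open import Data.List.Relation.Unary.All using (All)
open import Data.Maybe using (Maybe; just; nothing)
open import Data.Product using (Σ; _×_; ∃)
open import Data.Empty using (⊥)
open import Data.Integer using (+_)
open import Data.Rational using (ℚ; _/_; 0ℚ) renaming (_+_ to _+ℚ_)
open import Relation.Nullary using (¬_)
open import Relation.Nullary.Decidable using (¬?)
open import Relation.Binary.PropositionalEquality using (_≡_)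

-- Rooted planar trees in which every vertex has 0 or d (ordered) children.
-- Trees with k internal vertices (internal T ≡ k) form C_k^(d).
data Tree (d : ℕ) : Set where
  leaf : Tree d
  node : Vec (Tree d) d → Tree d

module _ {d : ℕ} where

  mutual
    internal : Tree d → ℕ
    internal leaf      = 0
    internal (node ts) = suc (internalV ts)

    internalV : ∀ {n} → Vec (Tree d) n → ℕ
    internalV []       = 0
    internalV (t ∷ ts) = internal t + internalV ts

  mutual
    N : ℕ → Tree d → ℕ
    N zero    t         = 1
    N (suc j) leaf      = 0
    N (suc j) (node ts) = NV j ts

    NV : ∀ {n} → ℕ → Vec (Tree d) n → ℕ
    NV j []       = 0
    NV j (t ∷ ts) = N j t + NV j ts

  mutual
    Nge : ℕ → Tree d → ℕ
    Nge zero    leaf      = 1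
    Nge zero    (node ts) = suc (NgeV zero ts)
    Nge (suc q) leaf      = 0
    Nge (suc q) (node ts) = NgeV q ts

    NgeV : ∀ {n} → ℕ → Vec (Tree d) n → ℕ
    NgeV q []       = 0
    NgeV q (t ∷ ts) = Nge q t + NgeV q ts

  Nle : ℕ → Tree d → ℕ
  Nle q T = sum (map (λ j → N j T) (upTo (suc q)))

  J : (p m : ℕ) → Tree d → ℕ
  J p m T = Nge (m * (p ∸ 1) + 1) T
            * product (map (λ i → Nle (i * (p ∸ 1)) T) (map suc (upTo (m ∸ 1))))

  subtreeAt : Tree d → List (Fin d) → Maybe (Tree d)
  subtreeAt t         []      = just t
  subtreeAt leaf      (_ ∷ _) = nothing
  subtreeAt (node ts) (i ∷ a) = subtreeAt (lookup ts i) a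

  replaceAt : Tree d → List (Fin d) → Tree d → Maybe (Tree d)
  replaceAt t         []      s = just s
  replaceAt leaf      (_ ∷ _) s = nothing
  replaceAt (node ts) (i ∷ a) s =
    Data.Maybe.map (λ t′ → node (ts [ i ]≔ t′)) (replaceAt (lookup ts i) a s)

  others : Vec (Tree d) d → Fin d → List (Tree d)
  others ts i = map (lookup ts) (filter (λ j → ¬? (j ≟ i)) (allFin d))

  -- For a path starting at v₀ = root of t and descending along the child
  -- indices in s: the list of subtrees subtended by the siblings of v₁,…,v_p
  -- (nothing if the path does not exist).
  siblings : Tree d → List (Fin d) → Maybe (List (Tree d))
  siblings t         []      = just []
  siblings leaf      (_ ∷ _) = nothing
  siblings (node ts) (i ∷ s) with siblings (lookup ts i) s
  ... | nothing = nothing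
  ... | just L  = just (others ts i ++ L)

  -- u and u′ agree along the path s (same spine, same subtree at v_p);
  -- they may differ only in the sibling subtrees.
  SameSpine : Tree d → Tree d → List (Fin d) → Set
  SameSpine u         u′         []      = u ≡ u′
  SameSpine (node ts) (node ts′) (i ∷ s) = SameSpine (lookup ts i) (lookup ts′ i) s
  SameSpine _         _          (_ ∷ _) = ⊥

  -- A shuffle class is given by a base tree, the address of v₀ and the
  -- child indices of the steps v₀ → v₁ → … → v_p.
  record ShuffleData : Set where
    constructor shuffleData
    field
      base  : Tree d
      addr  : List (Fin d)
      steps : List (Fin d)
  open ShuffleData public

  ValidShuffle : (k p : ℕ) → ShuffleData → Set
  ValidShuffle k p c =
    internal (base c) ≡ k × length (steps c) ≡ p ×
    Σ (Tree d) λ u → Σ (List (Tree d)) λ L →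
      subtreeAt (base c) (addr c) ≡ just u × siblings u (steps c) ≡ just L

  -- T′ belongs to the shuffle class: T′ ∈ C_k^(d) and T′ is obtained from
  -- the base tree by rearranging the sibling subtrees along the path among
  -- the sibling positions.
  InClass : (k : ℕ) → ShuffleData → Tree d → Set
  InClass k c T′ =
    internal T′ ≡ k ×
    Σ (Tree d) λ u → Σ (Tree d) λ u′ →
      subtreeAt (base c) (addr c) ≡ just u ×
      replaceAt (base c) (addr c) u′ ≡ just T′ ×
      SameSpine u u′ (steps c) ×
      Σ (List (Tree d)) λ L → Σ (List (Tree d)) λ L′ →
        siblings u (steps c) ≡ just L × siblings u′ (steps c) ≡ just L′ × L′ ↭ L

  data LinComb (k : ℕ) (T : Tree d) : List (ShuffleData × ℚ) → ℚ → Set where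
    lc-nil : LinComb k T [] 0ℚ
    lc-in  : ∀ {S c cs q} → InClass k S T → LinComb k T cs q →
             LinComb k T ((S Data.Product., c) ∷ cs) (c +ℚ q)
    lc-out : ∀ {S c cs q} → ¬ InClass k S T → LinComb k T cs q →
             LinComb k T ((S Data.Product., c) ∷ cs) q

  InShuffleSpan : (k p : ℕ) → (Tree d → ℚ) → Set
  InShuffleSpan k p f =
    Σ (List (ShuffleData × ℚ)) λ cs →
      All (λ sc → ValidShuffle k p (Data.Product.proj₁ sc)) cs ×
      (∀ T → internal T ≡ k → LinComb k T cs (f T))

ℕtoℚ : ℕ → ℚ
ℕtoℚ n = + n / 1

-- Put q = (m − 1)(p − 1), so that m(p − 1) + 1 = q + p and J_m(T) = N_{≥q+p}(T) · w(T) with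
-- w(T) = Π_{i=1}^{m−1} N_{≤i(p−1)}(T), which depends only on the levels 0, …, q of T.  Every vertex at
-- depth ≥ q + p is the endpoint of exactly one ancestral path of length p starting at depth ≥ q, so
-- N_{≥q+p}(T) counts these paths.  Shuffling along such a path changes nothing at depth ≤ q, hence w is
-- constant on its shuffle class, and "T′ lies in the class of the path (a, s) of T" is an equivalence
-- relation on trees having a path at (a, s).  Summing w(R) · 1_{class of (R, a, s)} over one
-- representative R of each class, and over all positions (a, s) with |a| ≥ q, therefore gives
-- w(T′) · #{such paths of T′} = J_m(T′) at every T′ ∈ C_k^(d).

module Submission where

open import Defs
open import Data.Nat using (ℕ; zero; suc; _+_; _*_; _∸_; _≤_; _<_; s≤s)
import Data.Nat as Nat
open import Data.Nat.Properties
  using (+-commutativeSemigroup; +-assoc; +-comm; +-suc; +-identityʳ; *-distribʳ-+; *-monoˡ-≤;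
         ≤-refl; ≤-trans; ≤-<-trans; ≤-pred; m≤n⇒m≤1+n; m≤m+n; m≤n+m)
open import Algebra.Properties.CommutativeSemigroup +-commutativeSemigroup using (interchange)
open import Data.Nat.ListAction using (sum; product)
open import Data.Nat.ListAction.Properties using (sum-++)
open import Data.Nat.Coprimality using (1-coprimeTo) renaming (sym to coprime-sym)
open import Data.Fin as Fin using (Fin)
open import Data.Vec using (Vec; []; _∷_; lookup; _[_]≔_)
open import Data.Vec.Properties using ([]≔-idempotent; []≔-lookup; lookup∘update)
open import Data.List
  using (List; []; _∷_; _++_; [_]; map; concatMap; filter; deduplicate; length; tabulate; allFin; upTo)
open import Data.List.Properties
  using (map-++; map-∘; map-cong; map-cong-local; map-tabulate; filter-accept; filter-reject; filter-none)
open import Data.List.Relation.Unary.All as All using (All; []; _∷_)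
open import Data.List.Relation.Unary.All.Properties
  using (all-filter; filter⁺; deduplicate⁺; applyUpTo⁺₁; concat⁺; map⁺)
open import Data.List.Relation.Unary.Any as Any using (Any; here; there)
open import Data.List.Membership.Propositional using (_∈_)
open import Data.List.Membership.Propositional.Properties using (∈-∃++; ∈-map⁺; ∈-concatMap⁺; ∈-filter⁺)
import Data.List.Membership.DecPropositional as DecMembership
open import Data.List.Relation.Binary.Permutation.Propositional using (_↭_; ↭-refl; ↭-sym; ↭-trans; prep)
open import Data.List.Relation.Binary.Permutation.Propositional.Properties using (∈-resp-↭; ¬x∷xs↭[]; shift; drop-∷)
open import Data.Maybe using (Maybe; just; nothing; maybe′)
open import Data.Maybe.Properties using (just-injective) renaming (≡-dec to ≡-dec-Maybe)
open import Data.Product using (Σ; _×_; _,_; proj₁; proj₂)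
import Data.Integer as ℤ
import Data.Integer.Properties as ℤ
open import Data.Rational using (ℚ; mkℚ; _/_) renaming (_+_ to _+ℚ_)
import Data.Rational.Properties as ℚ
open import Function using (_∘_; id; case_of_)
open import Relation.Nullary using (¬_; Dec; yes; no; contradiction)
open import Relation.Nullary.Decidable using (map′; _×-dec_; ¬?)
open import Level using (0ℓ)
open import Relation.Unary using (Pred; Decidable)
open import Relation.Binary using (Rel; Symmetric; Transitive; DecidableEquality)
import Relation.Binary as B
open import Relation.Binary.PropositionalEquality hiding ([_]; J)

sum-map-concatMap : ∀ {A B : Set} (f : B → ℕ) (g : A → List B) xs →
  sum (map f (concatMap g xs)) ≡ sum (map (λ x → sum (map f (g x))) xs)
sum-map-concatMap f g []       = refl
sum-map-concatMap f g (x ∷ xs) = begin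
  sum (map f (g x ++ concatMap g xs))              ≡⟨ cong sum (map-++ f (g x) _) ⟩
  sum (map f (g x) ++ map f (concatMap g xs))      ≡⟨ sum-++ (map f (g x)) _ ⟩
  sum (map f (g x)) + sum (map f (concatMap g xs)) ≡⟨ cong (sum (map f (g x)) +_) (sum-map-concatMap f g xs) ⟩
  sum (map f (g x)) + sum (map (λ y → sum (map f (g y))) xs) ∎
  where open ≡-Reasoning

sum-map-const : ∀ {A : Set} {f : A → ℕ} {c} {xs} → All (λ x → f x ≡ c) xs → sum (map f xs) ≡ length xs * c
sum-map-const []           = refl
sum-map-const (fx≡c ∷ all) = cong₂ _+_ fx≡c (sum-map-const all)

sum-map-zero : ∀ {A : Set} {f : A → ℕ} → (∀ x → f x ≡ 0) → ∀ xs → sum (map f xs) ≡ 0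
sum-map-zero f≡0 []       = refl
sum-map-zero f≡0 (x ∷ xs) = cong₂ _+_ (f≡0 x) (sum-map-zero f≡0 xs)

module _ {A : Set} {P Q : Pred A 0ℓ} (P? : Decidable P) (Q? : Decidable Q) (P⊆Q : ∀ {x} → P x → Q x) where

  filter-absorbs : ∀ xs → filter P? (filter Q? xs) ≡ filter P? xs
  filter-absorbs []       = refl
  filter-absorbs (x ∷ xs) with Q? x | P? x
  ... | yes _ | yes px = trans (filter-accept P? px) (cong (x ∷_) (filter-absorbs xs))
  ... | yes _ | no ¬px = trans (filter-reject P? ¬px) (filter-absorbs xs)
  ... | no ¬qx | yes px = contradiction (P⊆Q px) ¬qx
  ... | no _  | no _   = filter-absorbs xs

module _ {A : Set} {R : Rel A 0ℓ} (R? : B.Decidable R) (R-sym : Symmetric R) (R-trans : Transitive R) where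

  length-filter-deduplicate : ∀ {y} xs → Any (λ x → R x y) xs →
    length (filter (λ x → R? x y) (deduplicate R? xs)) ≡ 1
  length-filter-deduplicate {y} (x ∷ xs) xs∋y with R? x y
  ... | yes xRy = cong (suc ∘ length) (filter-none (λ z → R? z y) unrelated)
    where
    unrelated : All (λ z → ¬ R z y) (filter (¬? ∘ R? x) (deduplicate R? xs))
    unrelated = All.map (λ ¬xRz zRy → ¬xRz (R-trans xRy (R-sym zRy)))
                        (all-filter (¬? ∘ R? x) (deduplicate R? xs))
  ... | no ¬xRy = trans (cong length (filter-absorbs (λ z → R? z y) (¬? ∘ R? x) unrelated (deduplicate R? xs)))
                        (length-filter-deduplicate xs (tail xs∋y))
    where
    unrelated : ∀ {z} → R z y → ¬ R x z
    unrelated zRy xRz = ¬xRy (R-trans xRz zRy)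
    tail : Any (λ z → R z y) (x ∷ xs) → Any (λ z → R z y) xs
    tail (here xRy)  = contradiction xRy ¬xRy
    tail (there any) = any

module _ {A : Set} (_≟_ : DecidableEquality A) where
  open DecMembership _≟_ using (_∈?_)

  _↭?_ : (xs ys : List A) → Dec (xs ↭ ys)
  []       ↭? []       = yes ↭-refl
  []       ↭? (_ ∷ _)  = no (¬x∷xs↭[] ∘ ↭-sym)
  (x ∷ xs) ↭? ys with x ∈? ys
  ... | no x∉ys  = no λ p → x∉ys (∈-resp-↭ p (here refl))
  ... | yes x∈ys with ys₁ , ys₂ , refl ← ∈-∃++ x∈ys =
    map′ (λ p → ↭-trans (prep x p) (↭-sym (shift x ys₁ ys₂)))
         (λ p → drop-∷ (↭-trans p (shift x ys₁ ys₂)))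
         (xs ↭? (ys₁ ++ ys₂))

concatMap⁺ : ∀ {A B : Set} {P : Pred A 0ℓ} {Q : Pred B 0ℓ} (f : A → List B) →
  (∀ {x} → P x → All Q (f x)) → ∀ {xs} → All P xs → All Q (concatMap f xs)
concatMap⁺ f Q-f pxs = concat⁺ (map⁺ (All.map Q-f pxs))

vectorsOver : ∀ {A : Set} → List A → (n : ℕ) → List (Vec A n)
vectorsOver xs zero    = [ [] ]
vectorsOver xs (suc n) = concatMap (λ x → map (x ∷_) (vectorsOver xs n)) xs

∈-vectorsOver : ∀ {A : Set} {xs : List A} {n} (vs : Vec A n) →
  (∀ i → lookup vs i ∈ xs) → vs ∈ vectorsOver xs n
∈-vectorsOver []       _    = here refl
∈-vectorsOver (v ∷ vs) vs⊆ =
  ∈-concatMap⁺ (λ x → map (x ∷_) (vectorsOver _ _))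
    (Any.map (λ { refl → ∈-map⁺ (v ∷_) (∈-vectorsOver vs (vs⊆ ∘ Fin.suc)) }) (vs⊆ Fin.zero))

-- Linear combinations of shuffle-class indicators

ℕtoℚ≡mkℚ : ∀ n → ℕtoℚ n ≡ mkℚ (ℤ.+ n) 0 (coprime-sym (1-coprimeTo n))
ℕtoℚ≡mkℚ n = ℚ.normalize-coprime (coprime-sym (1-coprimeTo n))

ℕtoℚ-+ : ∀ m n → ℕtoℚ (m + n) ≡ ℕtoℚ m +ℚ ℕtoℚ n
ℕtoℚ-+ m n rewrite ℕtoℚ≡mkℚ m | ℕtoℚ≡mkℚ n =
  cong (_/ 1) (sym (cong₂ ℤ._+_ (ℤ.*-identityʳ (ℤ.+ m)) (ℤ.*-identityʳ (ℤ.+ n))))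

module _ {d k : ℕ} {T : Tree d} where

  LinComb-++ : ∀ {cs cs′ q q′} → LinComb k T cs q → LinComb k T cs′ q′ → LinComb k T (cs ++ cs′) (q +ℚ q′)
  LinComb-++ lc-nil lc′ = subst (LinComb k T _) (sym (ℚ.+-identityˡ _)) lc′
  LinComb-++ {q′ = q′} (lc-in {c = c} {q = q} inS lc) lc′ =
    subst (LinComb k T _) (sym (ℚ.+-assoc c q q′)) (lc-in inS (LinComb-++ lc lc′))
  LinComb-++ (lc-out ¬inS lc) lc′ = lc-out ¬inS (LinComb-++ lc lc′)

  LinComb-concatMap : ∀ {A : Set} {P : Pred A 0ℓ} (f : A → List (ShuffleData × ℚ)) (h : A → ℕ) c →
    (∀ {x} → P x → LinComb k T (f x) (ℕtoℚ (h x * c))) →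
    ∀ {xs} → All P xs → LinComb k T (concatMap f xs) (ℕtoℚ (sum (map h xs) * c))
  LinComb-concatMap f h c lc [] = lc-nil
  LinComb-concatMap f h c lc {x ∷ xs} (px ∷ pxs) =
    subst (LinComb k T _) (sym (trans (cong ℕtoℚ (*-distribʳ-+ c (h x) _)) (ℕtoℚ-+ (h x * c) _)))
      (LinComb-++ (lc px) (LinComb-concatMap f h c lc pxs))

  LinComb-map : ∀ {A : Set} {R : Pred A 0ℓ} (R? : Decidable R) (S : A → ShuffleData) (c : A → ℕ) →
    (∀ {x} → InClass k (S x) T → R x) → (∀ {x} → R x → InClass k (S x) T) →
    ∀ xs → LinComb k T (map (λ x → S x , ℕtoℚ (c x)) xs) (ℕtoℚ (sum (map c (filter R? xs))))
  LinComb-map R? S c sound complete []       = lc-nil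
  LinComb-map R? S c sound complete (x ∷ xs) with R? x
  ... | yes Rx = subst (LinComb k T _) (sym (ℕtoℚ-+ (c x) _))
                       (lc-in (complete Rx) (LinComb-map R? S c sound complete xs))
  ... | no ¬Rx = lc-out (¬Rx ∘ sound) (LinComb-map R? S c sound complete xs)

-- Shuffle classes as an equivalence relation

module _ {d : ℕ} where

  Address : Set
  Address = List (Fin d)

  node-injective : {ts ts′ : Vec (Tree d) d} → node ts ≡ node ts′ → ts ≡ ts′
  node-injective refl = refl

  mutual
    _≟_ : DecidableEquality (Tree d)
    leaf    ≟ leaf     = yes refl
    leaf    ≟ node _   = no λ ()
    node _  ≟ leaf     = no λ ()
    node ts ≟ node ts′ = map′ (cong node) node-injective (ts ≟ⱽ ts′)

    _≟ⱽ_ : ∀ {n} → DecidableEquality (Vec (Tree d) n)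
    []       ≟ⱽ []         = yes refl
    (t ∷ ts) ≟ⱽ (t′ ∷ ts′) with t ≟ t′ | ts ≟ⱽ ts′
    ... | yes refl | yes refl = yes refl
    ... | no t≢t′  | _        = no λ { refl → t≢t′ refl }
    ... | yes _    | no ts≢ts′ = no λ { refl → ts≢ts′ refl }

  SameSpine? : ∀ (u u′ : Tree d) s → Dec (SameSpine u u′ s)
  SameSpine? u         u′         []      = u ≟ u′
  SameSpine? leaf      _          (_ ∷ _) = no λ ()
  SameSpine? (node _)  leaf       (_ ∷ _) = no λ ()
  SameSpine? (node ts) (node ts′) (i ∷ s) = SameSpine? (lookup ts i) (lookup ts′ i) s

  SameSpine-sym : ∀ (u u′ : Tree d) s → SameSpine u u′ s → SameSpine u′ u s
  SameSpine-sym u         u′         []      eq   = sym eq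
  SameSpine-sym (node ts) (node ts′) (i ∷ s) same = SameSpine-sym (lookup ts i) (lookup ts′ i) s same

  SameSpine-trans : ∀ (u u′ u″ : Tree d) s → SameSpine u u′ s → SameSpine u′ u″ s → SameSpine u u″ s
  SameSpine-trans u u′ u″ [] eq eq′ = trans eq eq′
  SameSpine-trans (node ts) (node ts′) (node ts″) (i ∷ s) same same′ =
    SameSpine-trans (lookup ts i) (lookup ts′ i) (lookup ts″ i) s same same′

  siblings-child : ∀ ts i s {L} → siblings (node ts) (i ∷ s) ≡ just L →
    Σ (List (Tree d)) λ L′ → siblings (lookup ts i) s ≡ just L′
  siblings-child ts i s eq with siblings (lookup ts i) s
  siblings-child ts i s () | nothing
  ... | just L′ = L′ , refl

  SameSpine-refl : ∀ (u : Tree d) s {L} → siblings u s ≡ just L → SameSpine u u s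
  SameSpine-refl u         []      _  = refl
  SameSpine-refl (node ts) (i ∷ s) eq = SameSpine-refl (lookup ts i) s (proj₂ (siblings-child ts i s eq))

  SiblingsPermuted : Maybe (List (Tree d)) → Maybe (List (Tree d)) → Set
  SiblingsPermuted m m′ = Σ (List (Tree d)) λ L → Σ (List (Tree d)) λ L′ → m ≡ just L × m′ ≡ just L′ × L′ ↭ L

  SiblingsPermuted? : ∀ m m′ → Dec (SiblingsPermuted m m′)
  SiblingsPermuted? nothing  _         = no λ ()
  SiblingsPermuted? (just _) nothing   = no λ { (_ , _ , _ , () , _) }
  SiblingsPermuted? (just L) (just L′) =
    map′ (λ L′↭L → L , L′ , refl , refl , L′↭L) (λ { (_ , _ , refl , refl , L′↭L) → L′↭L }) ((_≟_ ↭? L′) L)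

  PathShuffle : Address → Tree d → Tree d → Set
  PathShuffle s u u′ = SameSpine u u′ s × SiblingsPermuted (siblings u s) (siblings u′ s)

  PathShuffle? : ∀ s u u′ → Dec (PathShuffle s u u′)
  PathShuffle? s u u′ = SameSpine? u u′ s ×-dec SiblingsPermuted? (siblings u s) (siblings u′ s)

  PathShuffle-refl : ∀ s u {L} → siblings u s ≡ just L → PathShuffle s u u
  PathShuffle-refl s u {L} eq = SameSpine-refl u s eq , L , L , eq , eq , ↭-refl

  PathShuffle-sym : ∀ s u u′ → PathShuffle s u u′ → PathShuffle s u′ u
  PathShuffle-sym s u u′ (same , L , L′ , eq , eq′ , L′↭L) =
    SameSpine-sym u u′ s same , L′ , L , eq′ , eq , ↭-sym L′↭L

  PathShuffle-trans : ∀ s u u′ u″ → PathShuffle s u u′ → PathShuffle s u′ u″ → PathShuffle s u u″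
  PathShuffle-trans s u u′ u″ (same , L , L′ , eq₁ , eq₂ , L′↭L) (same′ , M , M′ , eq₃ , eq₄ , M′↭M)
    with refl ← just-injective (trans (sym eq₂) eq₃) =
    SameSpine-trans u u′ u″ s same same′ , L , M′ , eq₁ , eq₄ , ↭-trans M′↭M L′↭L

  subtreeAt-replaceAt : ∀ (T : Tree d) a {u T′} → replaceAt T a u ≡ just T′ → subtreeAt T′ a ≡ just u
  subtreeAt-replaceAt T         []      refl = refl
  subtreeAt-replaceAt (node ts) (i ∷ a) {u} eq with replaceAt (lookup ts i) a u in eqᵢ
  subtreeAt-replaceAt (node ts) (i ∷ a) refl | just t
    rewrite lookup∘update i ts t = subtreeAt-replaceAt (lookup ts i) a eqᵢ

  replaceAt-subtreeAt : ∀ (T : Tree d) a {u} → subtreeAt T a ≡ just u → replaceAt T a u ≡ just T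
  replaceAt-subtreeAt T         []      refl = refl
  replaceAt-subtreeAt (node ts) (i ∷ a) eq
    rewrite replaceAt-subtreeAt (lookup ts i) a eq | []≔-lookup ts i = refl

  replaceAt-replaceAt : ∀ (T : Tree d) a {u T′} → replaceAt T a u ≡ just T′ →
    ∀ v → replaceAt T′ a v ≡ replaceAt T a v
  replaceAt-replaceAt T         []      refl v = refl
  replaceAt-replaceAt (node ts) (i ∷ a) {u} eq v with replaceAt (lookup ts i) a u in eqᵢ
  replaceAt-replaceAt (node ts) (i ∷ a) refl v | just t
    rewrite lookup∘update i ts t | replaceAt-replaceAt (lookup ts i) a eqᵢ v
    with replaceAt (lookup ts i) a v
  ... | nothing = refl
  ... | just t′ = cong (just ∘ node) ([]≔-idempotent ts i)

  -- InClass k (shuffleData T a s) T′ unfolds to internal T′ ≡ k × ShuffleRelated a s T T′.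
  ShuffleRelated : Address → Address → Tree d → Tree d → Set
  ShuffleRelated a s T T′ = Σ (Tree d) λ u → Σ (Tree d) λ u′ →
    subtreeAt T a ≡ just u × replaceAt T a u′ ≡ just T′ × PathShuffle s u u′

  HasPath : Tree d → Address → Address → Set
  HasPath T a s = Σ (Tree d) λ u → Σ (List (Tree d)) λ L → subtreeAt T a ≡ just u × siblings u s ≡ just L

  module _ (a s : Address) where

    ShuffleRelated-refl : ∀ {T} → HasPath T a s → ShuffleRelated a s T T
    ShuffleRelated-refl {T} (u , L , eq , eqᴸ) = u , u , eq , replaceAt-subtreeAt T a eq , PathShuffle-refl s u eqᴸ

    ShuffleRelated-sym : Symmetric (ShuffleRelated a s)
    ShuffleRelated-sym {T} {T′} (u , u′ , eq , eq′ , shuffle) =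
      u′ , u , subtreeAt-replaceAt T a eq′ ,
      trans (replaceAt-replaceAt T a eq′ u) (replaceAt-subtreeAt T a eq) ,
      PathShuffle-sym s u u′ shuffle

    ShuffleRelated-trans : Transitive (ShuffleRelated a s)
    ShuffleRelated-trans {T} {T′} {T″} (u , u′ , eq₁ , eq₂ , shuffle) (v , v′ , eq₃ , eq₄ , shuffle′)
      with refl ← just-injective (trans (sym (subtreeAt-replaceAt T a eq₂)) eq₃) =
      u , v′ , eq₁ , trans (sym (replaceAt-replaceAt T a eq₂ v′)) eq₄ , PathShuffle-trans s u u′ v′ shuffle shuffle′

    ShuffleRelated⇒HasPath : ∀ {T T′} → ShuffleRelated a s T T′ → HasPath T a s
    ShuffleRelated⇒HasPath (u , _ , eq , _ , _ , L , _ , eqᴸ , _) = u , L , eq , eqᴸ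

    ShuffleRelated? : B.Decidable (ShuffleRelated a s)
    ShuffleRelated? T T′ with subtreeAt T a in eq | subtreeAt T′ a in eq′
    ... | nothing | _ = no λ ()
    ... | just _ | nothing = no λ (_ , _ , _ , e , _) → case trans (sym eq′) (subtreeAt-replaceAt T a e) of λ ()
    ... | just u | just u′ =
      map′ (λ (e , shuffle) → u , u′ , refl , e , shuffle) (λ (_ , _ , e , e′ , shuffle) → unique e e′ shuffle)
           (≡-dec-Maybe _≟_ (replaceAt T a u′) (just T′) ×-dec PathShuffle? s u u′)
      where
      unique : ∀ {v v′} → just u ≡ just v → replaceAt T a v′ ≡ just T′ → PathShuffle s v v′ →
               replaceAt T a u′ ≡ just T′ × PathShuffle s u u′
      unique refl e′ shuffle with refl ← trans (sym eq′) (subtreeAt-replaceAt T a e′) = e′ , shuffle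

    HasPath? : ∀ T → Dec (HasPath T a s)
    HasPath? T with subtreeAt T a
    ... | nothing = no λ ()
    ... | just u with siblings u s in eqᴸ
    ...   | nothing = no λ { (_ , _ , refl , e) → case trans (sym eqᴸ) e of λ () }
    ...   | just L  = yes (u , L , refl , eqᴸ)

  -- Level counts

  NV-update : ∀ j {n} (ts : Vec (Tree d) n) i {t} → N j (lookup ts i) ≡ N j t → NV j ts ≡ NV j (ts [ i ]≔ t)
  NV-update j (t ∷ ts) Fin.zero    eq = cong (_+ NV j ts) eq
  NV-update j (t ∷ ts) (Fin.suc i) eq = cong (N j t +_) (NV-update j ts i eq)

  N-replaceAt : ∀ (T : Tree d) a {u T′} → replaceAt T a u ≡ just T′ → ∀ j → j ≤ length a → N j T ≡ N j T′
  N-replaceAt T a eq zero _ = refl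
  N-replaceAt (node ts) (i ∷ a) {u} eq (suc j) (s≤s j≤a) with replaceAt (lookup ts i) a u in eqᵢ
  N-replaceAt (node ts) (i ∷ a) refl (suc j) (s≤s j≤a) | just t =
    NV-update j ts i (N-replaceAt (lookup ts i) a eqᵢ j j≤a)

  ShuffleRelated⇒N≡ : ∀ a s {T T′} → ShuffleRelated a s T T′ → ∀ j → j ≤ length a → N j T ≡ N j T′
  ShuffleRelated⇒N≡ a s {T} (_ , _ , _ , eq , _) = N-replaceAt T a eq

  NV-allFin : ∀ j {n} (ts : Vec (Tree d) n) → NV j ts ≡ sum (map (N j ∘ lookup ts) (allFin n))
  NV-allFin j ts = trans (NV-tabulate ts) (cong sum (sym (map-tabulate id (N j ∘ lookup ts))))
    where
    NV-tabulate : ∀ {n} (ts : Vec (Tree d) n) → NV j ts ≡ sum (tabulate (N j ∘ lookup ts))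
    NV-tabulate []       = refl
    NV-tabulate (t ∷ ts) = cong (N j t +_) (NV-tabulate ts)

  addresses : ℕ → List Address
  addresses zero    = [ [] ]
  addresses (suc n) = concatMap (λ i → map (i ∷_) (addresses n)) (allFin d)

  sum-addresses-suc : ∀ n (f : Address → ℕ) →
    sum (map f (addresses (suc n))) ≡ sum (map (λ i → sum (map (f ∘ (i ∷_)) (addresses n))) (allFin d))
  sum-addresses-suc n f = trans (sum-map-concatMap f _ (allFin d))
    (cong sum (map-cong (λ i → cong sum (sym (map-∘ (addresses n)))) (allFin d)))

  count-subtreeAt : ∀ n p (T : Tree d) →
    sum (map (λ a → maybe′ (N p) 0 (subtreeAt T a)) (addresses n)) ≡ N (n + p) T
  count-subtreeAt zero    p T         = +-identityʳ (N p T)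
  count-subtreeAt (suc n) p leaf      =
    trans (sum-addresses-suc n _) (sum-map-zero (λ _ → sum-map-zero (λ _ → refl) (addresses n)) (allFin d))
  count-subtreeAt (suc n) p (node ts) = begin
    sum (map (λ a → maybe′ (N p) 0 (subtreeAt (node ts) a)) (addresses (suc n)))
      ≡⟨ sum-addresses-suc n _ ⟩
    sum (map (λ i → sum (map (λ a → maybe′ (N p) 0 (subtreeAt (lookup ts i) a)) (addresses n))) (allFin d))
      ≡⟨ cong sum (map-cong (λ i → count-subtreeAt n p (lookup ts i)) (allFin d)) ⟩
    sum (map (λ i → N (n + p) (lookup ts i)) (allFin d))
      ≡⟨ sym (NV-allFin (n + p) ts) ⟩
    NV (n + p) ts ∎
    where open ≡-Reasoning

  indicator : ∀ {A : Set} → Maybe A → ℕ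
  indicator = maybe′ (λ _ → 1) 0

  indicator-siblings : ∀ (u : Tree d) s → indicator (siblings u s) ≡ indicator (subtreeAt u s)
  indicator-siblings u         []      = refl
  indicator-siblings leaf      (_ ∷ _) = refl
  indicator-siblings (node ts) (i ∷ s) with siblings (lookup ts i) s | indicator-siblings (lookup ts i) s
  ... | nothing | eq = eq
  ... | just _  | eq = eq

  pathIndicator : Tree d → Address → Address → ℕ
  pathIndicator T a s = maybe′ (λ u → indicator (siblings u s)) 0 (subtreeAt T a)

  pathIndicator-HasPath : ∀ T a s → HasPath T a s → pathIndicator T a s ≡ 1
  pathIndicator-HasPath T a s (_ , _ , eq , eqᴸ) rewrite eq | eqᴸ = refl

  pathIndicator-¬HasPath : ∀ T a s → ¬ HasPath T a s → pathIndicator T a s ≡ 0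
  pathIndicator-¬HasPath T a s ¬path with subtreeAt T a in eq
  ... | nothing = refl
  ... | just u with siblings u s in eqᴸ
  ...   | nothing = refl
  ...   | just L  = contradiction (u , L , refl , eqᴸ) ¬path

  -- Each vertex at depth n + p is the end of exactly one length-p path from depth n.
  count-paths : ∀ n p (T : Tree d) →
    sum (map (λ a → sum (map (pathIndicator T a) (addresses p))) (addresses n)) ≡ N (n + p) T
  count-paths n p T =
    trans (cong sum (map-cong (λ a → paths-below (subtreeAt T a)) (addresses n))) (count-subtreeAt n p T)
    where
    paths-below : ∀ mu →
      sum (map (λ s → maybe′ (λ u → indicator (siblings u s)) 0 mu) (addresses p)) ≡ maybe′ (N p) 0 mu
    paths-below nothing  = sum-map-zero (λ _ → refl) (addresses p)
    paths-below (just u) = begin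
      sum (map (λ s → indicator (siblings u s)) (addresses p))
        ≡⟨ cong sum (map-cong (indicator-siblings u) (addresses p)) ⟩
      sum (map (λ s → maybe′ (N 0) 0 (subtreeAt u s)) (addresses p))
        ≡⟨ count-subtreeAt p 0 u ⟩
      N (p + 0) u
        ≡⟨ cong (λ j → N j u) (+-identityʳ p) ⟩
      N p u ∎
      where open ≡-Reasoning

  mutual
    Nge-suc : ∀ Q (T : Tree d) → Nge Q T ≡ N Q T + Nge (suc Q) T
    Nge-suc zero    leaf      = refl
    Nge-suc zero    (node ts) = refl
    Nge-suc (suc Q) leaf      = refl
    Nge-suc (suc Q) (node ts) = NgeV-suc Q ts

    NgeV-suc : ∀ Q {n} (ts : Vec (Tree d) n) → NgeV Q ts ≡ NV Q ts + NgeV (suc Q) ts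
    NgeV-suc Q []       = refl
    NgeV-suc Q (t ∷ ts) = trans (cong₂ _+_ (Nge-suc Q t) (NgeV-suc Q ts)) (interchange (N Q t) _ (NV Q ts) _)

  mutual
    Nge-vanish : ∀ Q (T : Tree d) → internal T < Q → Nge Q T ≡ 0
    Nge-vanish (suc Q) leaf      _            = refl
    Nge-vanish (suc Q) (node ts) (s≤s ts<Q) = NgeV-vanish Q ts ts<Q

    NgeV-vanish : ∀ Q {n} (ts : Vec (Tree d) n) → internalV ts < Q → NgeV Q ts ≡ 0
    NgeV-vanish Q []       _    = refl
    NgeV-vanish Q (t ∷ ts) ts<Q = cong₂ _+_
      (Nge-vanish Q t (≤-<-trans (m≤m+n (internal t) _) ts<Q))
      (NgeV-vanish Q ts (≤-<-trans (m≤n+m (internalV ts) (internal t)) ts<Q))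

  depthsFrom : ℕ → ℕ → List ℕ
  depthsFrom Q zero    = []
  depthsFrom Q (suc L) = Q ∷ depthsFrom (suc Q) L

  Nge-split : ∀ L Q p (T : Tree d) →
    Nge (Q + p) T ≡ sum (map (λ n → N (n + p) T) (depthsFrom Q L)) + Nge (Q + L + p) T
  Nge-split zero    Q p T = cong (λ n → Nge (n + p) T) (sym (+-identityʳ Q))
  Nge-split (suc L) Q p T = begin
    Nge (Q + p) T
      ≡⟨ Nge-suc (Q + p) T ⟩
    N (Q + p) T + Nge (suc Q + p) T
      ≡⟨ cong (N (Q + p) T +_) (Nge-split L (suc Q) p T) ⟩
    N (Q + p) T + (sum (map (λ n → N (n + p) T) (depthsFrom (suc Q) L)) + Nge (suc Q + L + p) T)
      ≡⟨ sym (+-assoc (N (Q + p) T) _ _) ⟩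
    sum (map (λ n → N (n + p) T) (depthsFrom Q (suc L))) + Nge (suc Q + L + p) T
      ≡⟨ cong (λ e → sum (map (λ n → N (n + p) T) (depthsFrom Q (suc L))) + Nge (e + p) T) (sym (+-suc Q L)) ⟩
    sum (map (λ n → N (n + p) T) (depthsFrom Q (suc L))) + Nge (Q + suc L + p) T ∎
    where open ≡-Reasoning

  -- The spanning family

  treesUpTo : ℕ → List (Tree d)
  treesUpTo zero    = [ leaf ]
  treesUpTo (suc n) = leaf ∷ map node (vectorsOver (treesUpTo n) d)

  internal-lookup : ∀ {n} (ts : Vec (Tree d) n) i → internal (lookup ts i) ≤ internalV ts
  internal-lookup (t ∷ ts) Fin.zero    = m≤m+n (internal t) _
  internal-lookup (t ∷ ts) (Fin.suc i) = ≤-trans (internal-lookup ts i) (m≤n+m _ (internal t))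

  ∈-treesUpTo : ∀ n (T : Tree d) → internal T ≤ n → T ∈ treesUpTo n
  ∈-treesUpTo zero    leaf      _          = here refl
  ∈-treesUpTo (suc n) leaf      _          = here refl
  ∈-treesUpTo (suc n) (node ts) (s≤s ts≤n) =
    there (∈-map⁺ node (∈-vectorsOver ts λ i → ∈-treesUpTo n (lookup ts i) (≤-trans (internal-lookup ts i) ts≤n)))

  treesOfSize : ℕ → List (Tree d)
  treesOfSize k = filter (λ T → internal T Nat.≟ k) (treesUpTo k)

  ∈-treesOfSize : ∀ {k} {T : Tree d} → internal T ≡ k → T ∈ treesOfSize k
  ∈-treesOfSize {k} {T} refl = ∈-filter⁺ (λ T → internal T Nat.≟ k) (∈-treesUpTo k T ≤-refl) refl

  addresses-length : ∀ n → All (λ a → length a ≡ n) (addresses n)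
  addresses-length zero    = refl ∷ []
  addresses-length (suc n) =
    concat⁺ (map⁺ (All.tabulate {xs = allFin d} λ {i} _ →
      map⁺ {f = i ∷_} (All.map (cong suc) (addresses-length n))))

  depthsFrom-≥ : ∀ {P} Q L → P ≤ Q → All (P ≤_) (depthsFrom Q L)
  depthsFrom-≥ Q zero    _   = []
  depthsFrom-≥ Q (suc L) P≤Q = P≤Q ∷ depthsFrom-≥ (suc Q) L (m≤n⇒m≤1+n P≤Q)

  InShuffleSpan-cong : ∀ {k p} {f g : Tree d → ℚ} → (∀ T → internal T ≡ k → f T ≡ g T) →
    InShuffleSpan k p f → InShuffleSpan k p g
  InShuffleSpan-cong {k} f≡g (cs , valid , lc) = cs , valid , λ T ik → subst (LinComb k T cs) (f≡g T ik) (lc T ik)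

  DeterminedUpToDepth : ℕ → (Tree d → ℕ) → Set
  DeterminedUpToDepth q w = ∀ {T T′} → (∀ j → j ≤ q → N j T ≡ N j T′) → w T ≡ w T′

  module DeepPaths (k p q : ℕ) (w : Tree d → ℕ) (w-local : DeterminedUpToDepth q w) where

    representatives : Address → Address → List (Tree d)
    representatives a s = deduplicate (ShuffleRelated? a s) (filter (HasPath? a s) (treesOfSize k))

    representatives-valid : ∀ a s → All (λ T → internal T ≡ k × HasPath T a s) (representatives a s)
    representatives-valid a s = deduplicate⁺ (ShuffleRelated? a s)
      (All.zip (filter⁺ (HasPath? a s) (all-filter _ (treesUpTo k)) , all-filter (HasPath? a s) (treesOfSize k)))

    classesContaining : ∀ {T′} a s → internal T′ ≡ k →
      length (filter (λ T → ShuffleRelated? a s T T′) (representatives a s)) ≡ pathIndicator T′ a s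
    classesContaining {T′} a s ik with HasPath? a s T′
    ... | yes path = trans
      (length-filter-deduplicate (ShuffleRelated? a s) (ShuffleRelated-sym a s) (ShuffleRelated-trans a s)
        (filter (HasPath? a s) (treesOfSize k))
        (Any.map (λ { refl → ShuffleRelated-refl a s path }) (∈-filter⁺ (HasPath? a s) (∈-treesOfSize ik) path)))
      (sym (pathIndicator-HasPath T′ a s path))
    ... | no ¬path = trans
      (cong length (filter-none (λ T → ShuffleRelated? a s T T′)
        (All.tabulate {xs = representatives a s} λ _ related →
          ¬path (ShuffleRelated⇒HasPath a s (ShuffleRelated-sym a s related)))))
      (sym (pathIndicator-¬HasPath T′ a s ¬path))

    classesAt : Address → Address → List (ShuffleData × ℚ)
    classesAt a s = map (λ T → shuffleData T a s , ℕtoℚ (w T)) (representatives a s)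

    LinComb-classesAt : ∀ {T′} a s → internal T′ ≡ k → q ≤ length a →
      LinComb k T′ (classesAt a s) (ℕtoℚ (pathIndicator T′ a s * w T′))
    LinComb-classesAt {T′} a s ik q≤a =
      subst (LinComb k T′ (classesAt a s)) (cong ℕtoℚ value)
        (LinComb-map (λ T → ShuffleRelated? a s T T′) (λ T → shuffleData T a s) w proj₂ (ik ,_) (representatives a s))
      where
      value : sum (map w (filter (λ T → ShuffleRelated? a s T T′) (representatives a s)))
              ≡ pathIndicator T′ a s * w T′
      value = trans
        (sum-map-const (All.map (λ related → w-local λ j j≤q → ShuffleRelated⇒N≡ a s related j (≤-trans j≤q q≤a))
                                (all-filter (λ T → ShuffleRelated? a s T T′) (representatives a s))))
        (cong (_* w T′) (classesContaining a s ik))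

    classes : List (ShuffleData × ℚ)
    classes = concatMap (λ n → concatMap (λ a → concatMap (classesAt a) (addresses p)) (addresses n))
                        (depthsFrom q (suc k))

    classes-valid : All (λ c → ValidShuffle k p (proj₁ c)) classes
    classes-valid =
      concatMap⁺ _ (λ {n} _ → concatMap⁺ _ (λ {a} _ → concatMap⁺ (classesAt a)
        (λ {s} s≡p → map⁺ (All.map (λ (ik , path) → ik , s≡p , path) (representatives-valid a s)))
        (addresses-length p)) (addresses-length n)) (depthsFrom-≥ q (suc k) ≤-refl)

    pathsAt : Tree d → Address → ℕ
    pathsAt T a = sum (map (pathIndicator T a) (addresses p))

    pathsAtDepth : Tree d → ℕ → ℕ
    pathsAtDepth T n = sum (map (pathsAt T) (addresses n))

    pathSum : Tree d → ℕ
    pathSum T = sum (map (pathsAtDepth T) (depthsFrom q (suc k)))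

    LinComb-classes : ∀ {T′} → internal T′ ≡ k → LinComb k T′ classes (ℕtoℚ (pathSum T′ * w T′))
    LinComb-classes {T′} ik =
      LinComb-concatMap _ (pathsAtDepth T′) (w T′) (λ {n} q≤n →
        LinComb-concatMap _ (pathsAt T′) (w T′) (λ {a} a≡n →
          LinComb-concatMap (classesAt a) (pathIndicator T′ a) (w T′)
            (λ {s} _ → LinComb-classesAt a s ik (subst (q ≤_) (sym a≡n) q≤n))
            (addresses-length p))
          (addresses-length n))
        (depthsFrom-≥ q (suc k) ≤-refl)

    pathSum≡Nge : ∀ {T} → internal T ≡ k → pathSum T ≡ Nge (q + p) T
    pathSum≡Nge {T} ik = begin
      pathSum T                 ≡⟨ cong sum (map-cong (λ n → count-paths n p T) (depthsFrom q (suc k))) ⟩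
      levelSum                  ≡⟨ sym (+-identityʳ levelSum) ⟩
      levelSum + 0              ≡⟨ cong (levelSum +_) (sym (Nge-vanish (q + suc k + p) T deeper)) ⟩
      levelSum + Nge (q + suc k + p) T ≡⟨ sym (Nge-split (suc k) q p T) ⟩
      Nge (q + p) T             ∎
      where
      open ≡-Reasoning
      levelSum = sum (map (λ n → N (n + p) T) (depthsFrom q (suc k)))
      deeper : internal T < q + suc k + p
      deeper rewrite ik = ≤-trans (m≤n+m (suc k) q) (m≤m+n _ p)

  Nge-weighted-inShuffleSpan : ∀ k p q (w : Tree d → ℕ) → DeterminedUpToDepth q w →
    InShuffleSpan k p (λ T → ℕtoℚ (Nge (q + p) T * w T))
  Nge-weighted-inShuffleSpan k p q w w-local =
    classes , classes-valid , λ T ik →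
      subst (LinComb k T classes) (cong (λ n → ℕtoℚ (n * w T)) (pathSum≡Nge ik)) (LinComb-classes ik)
    where open DeepPaths k p q w w-local

  Nle-agree : ∀ e {T T′ : Tree d} → (∀ j → j ≤ e → N j T ≡ N j T′) → Nle e T ≡ Nle e T′
  Nle-agree e agree = cong sum (map-cong-local (applyUpTo⁺₁ id (suc e) λ j<1+e → agree _ (≤-pred j<1+e)))

  levelProduct : ℕ → ℕ → Tree d → ℕ
  levelProduct p m T = product (map (λ i → Nle (i * (p ∸ 1)) T) (map suc (upTo (m ∸ 1))))

  levelProduct-determined : ∀ p m → DeterminedUpToDepth ((m ∸ 1) * (p ∸ 1)) (levelProduct p m)
  levelProduct-determined p m agree = cong product (map-cong-local (map⁺ (applyUpTo⁺₁ id (m ∸ 1) λ i<m →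
    Nle-agree _ λ j j≤ → agree j (≤-trans j≤ (*-monoˡ-≤ (p ∸ 1) i<m)))))

  J≡Nge*levelProduct : ∀ p m (T : Tree d) →
    J (suc p) (suc m) T ≡ Nge (m * p + suc p) T * levelProduct (suc p) (suc m) T
  J≡Nge*levelProduct p m T = cong (λ e → Nge e T * levelProduct (suc p) (suc m) T) (begin
    p + m * p + 1   ≡⟨ +-comm (p + m * p) 1 ⟩
    suc (p + m * p) ≡⟨ cong suc (+-comm p (m * p)) ⟩
    suc (m * p + p) ≡⟨ sym (+-suc (m * p) p) ⟩
    m * p + suc p   ∎)
    where open ≡-Reasoning

corollary6p3 : (d p k : ℕ) → 2 ≤ d → 1 ≤ p → 1 ≤ k →
    (m : ℕ) → 1 ≤ m →
    InShuffleSpan {d} k p (λ T → ℕtoℚ (J p m T))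
corollary6p3 d (suc p) k _ (s≤s _) _ (suc m) (s≤s _) =
  InShuffleSpan-cong (λ T _ → cong ℕtoℚ (sym (J≡Nge*levelProduct p m T)))
    (Nge-weighted-inShuffleSpan k (suc p) (m * p) (levelProduct (suc p) (suc m))
      (levelProduct-determined (suc p) (suc m)))
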